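{- Let $t\ge s\ge 2$ and $r\ge 1$ be fixed integers. Then for every $m$, $\mathrm{mex}(m,K_{1,r},K_{s,t})=\binom{m}{r}$.
   Context: $\mathrm{mex}(m,H,F)$ is the maximum number of copies of $H$ in an $F$-free simple graph with $m$ edges. $K_{a,b}$ is the complete bipartite graph with parts of sizes $a$ and $b$ (so $K_{1,r}$ is the star with $r$ edges). -}

module Defs where

open import Data.Nat using (ℕ; _≤_)
open import Data.Nat.Combinatorics using (_C_)
open import Data.Fin using (Fin)
open import Data.Fin.Subset using (Subset; _∈_)
open import Data.Sum using (_⊎_; inj₁; inj₂)
open import Data.Product using (Σ; _×_; _,_; proj₁; proj₂; ∃; ∃-syntax)
open import Relation.Binary.PropositionalEquality using (_≡_; _≢_)
open import Relation.Nullary using (¬_)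
open import Function.Bundles using (_⇔_)

SameEdge : {n : ℕ} → Fin n × Fin n → Fin n × Fin n → Set
SameEdge (u , v) (u' , v') = (u ≡ u' × v ≡ v') ⊎ (u ≡ v' × v ≡ u')

record Graph (n m : ℕ) : Set where
  field
    edge     : Fin m → Fin n × Fin n
    loopless : ∀ e → proj₁ (edge e) ≢ proj₂ (edge e)
    distinct : ∀ e e' → SameEdge (edge e) (edge e') → e ≡ e'
open Graph public

Adj : {n m : ℕ} → Graph n m → Fin n → Fin n → Set
Adj G u v = ∃[ e ] SameEdge (edge G e) (u , v)

-- Vertices of K_{a,b}: two parts Fin a and Fin b; edges join the parts.
KV : ℕ → ℕ → Set
KV a b = Fin a ⊎ Fin b

InjectiveMap : {A : Set} {n : ℕ} → (A → Fin n) → Set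
InjectiveMap {A} f = ∀ (x y : A) → f x ≡ f y → x ≡ y

ContainsK : {n m : ℕ} → ℕ → ℕ → Graph n m → Set
ContainsK {n} a b G =
  Σ (KV a b → Fin n) λ f → InjectiveMap f ×
    (∀ (i : Fin a) (j : Fin b) → Adj G (f (inj₁ i)) (f (inj₂ j)))

KFree : {n m : ℕ} → ℕ → ℕ → Graph n m → Set
KFree a b G = ¬ ContainsK a b G

-- The edge subset S of G is the edge set of a copy of K_{a,b} in G
-- (a subgraph of G isomorphic to K_{a,b}; K_{a,b} has no isolated
-- vertices when a,b ≥ 1, so a copy is determined by its edge set).
IsCopyK : {n m : ℕ} → ℕ → ℕ → (G : Graph n m) → Subset m → Set
IsCopyK {n} {m} a b G S =
  Σ (KV a b → Fin n) λ f → InjectiveMap f ×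
    ((∀ (i : Fin a) (j : Fin b) → Adj G (f (inj₁ i)) (f (inj₂ j))) ×
     (∀ (e : Fin m) → (e ∈ S) ⇔
        (∃[ i ] ∃[ j ] SameEdge (edge G e) (f (inj₁ i) , f (inj₂ j)))))

AtLeastCopies : {n m : ℕ} → ℕ → ℕ → Graph n m → ℕ → Set
AtLeastCopies {n} {m} a b G N =
  Σ (Fin N → Subset m) λ L →
    (∀ i j → L i ≡ L j → i ≡ j) × (∀ i → IsCopyK a b G (L i))

AtMostCopies : {n m : ℕ} → ℕ → ℕ → Graph n m → ℕ → Set
AtMostCopies {n} {m} a b G N =
  ∀ (k : ℕ) (L : Fin k → Subset m) →
    (∀ i j → L i ≡ L j → i ≡ j) → (∀ i → IsCopyK a b G (L i)) → k ≤ N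

-- mex(m, K_{a,b}, K_{s,t}) = N : N is the maximum number of copies of
-- K_{a,b} in a K_{s,t}-free simple graph with m edges.
MexK : ℕ → ℕ → ℕ → ℕ → ℕ → ℕ → Set
MexK m a b s t N =
  (Σ ℕ λ n → Σ (Graph n m) λ G → KFree s t G × AtLeastCopies a b G N) ×
  (∀ (n : ℕ) (G : Graph n m) → KFree s t G → AtMostCopies a b G N)

{-# OPTIONS --safe #-}
module Submission where

open import Defs
open import Data.Nat using (ℕ; _≤_)
open import Data.Nat.Combinatorics using (_C_)

open import Data.Nat using (zero; suc; s≤s)
open import Data.Nat.Properties using (suc-injective; ≡-irrelevant; ≤-antisym; ≤-trans)
open import Data.Nat.Combinatorics using (nCk+nC[k+1]≡[n+1]C[k+1])
open import Data.Vec using ([]; _∷_; here; there)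
open import Data.Fin using (Fin; zero; suc)
open import Data.Fin.Patterns using (0F; 1F)
open import Data.Fin.Properties as Fin using (+↔⊎; injective⇒≤)
open import Data.Fin.Subset using (Subset; _∈_; ∣_∣; ⊥; inside; outside)
open import Data.Fin.Subset.Properties using (∣⊥∣≡0)
open import Data.Sum using (_⊎_; inj₁; inj₂)
open import Data.Sum.Properties using (inj₂-injective)
open import Data.Sum.Function.Propositional using (_⊎-cong_)
open import Data.Product using (Σ; _×_; _,_; proj₁; proj₂; ∃-syntax)
open import Function using (_∘_; case_of_)
open import Function.Bundles using (_⇔_; mk⇔; _↔_; mk↔ₛ′; Inverse; Injection; Equivalence)
open import Function.Definitions using (Injective)
open import Function.Properties.Inverse using (↔-sym; ↔-trans; ↔⇒↣)
open import Relation.Binary.PropositionalEquality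
  using (_≡_; _≢_; refl; sym; trans; cong; subst)
import Data.Empty as Empty

-- A copy of K_{1,r} is determined by its edge set, an r-subset of the
-- m edges, so no graph has more than C(m,r) copies. The star K_{1,m} has all
-- C(m,r) of them: any r of its edges span a copy. It is K_{s,t}-free because
-- every edge of a star meets its centre, whereas K_{2,2} ⊆ K_{s,t} has two
-- disjoint edges.

SubsetOfSize : ℕ → ℕ → Set
SubsetOfSize m r = Σ (Subset m) λ p → ∣ p ∣ ≡ r

SubsetOfSize-≡ : ∀ {m r} {x y : SubsetOfSize m r} → proj₁ x ≡ proj₁ y → x ≡ y
SubsetOfSize-≡ {x = p , eq} {y = .p , eq′} refl = cong (p ,_) (≡-irrelevant eq eq′)

∣p∣≡0⇒p≡⊥ : ∀ {m} {p : Subset m} → ∣ p ∣ ≡ 0 → p ≡ ⊥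
∣p∣≡0⇒p≡⊥ {p = []}          _  = refl
∣p∣≡0⇒p≡⊥ {p = outside ∷ p} eq = cong (outside ∷_) (∣p∣≡0⇒p≡⊥ eq)

SubsetOfSize[m,0]↔Fin1 : ∀ m → SubsetOfSize m 0 ↔ Fin 1
SubsetOfSize[m,0]↔Fin1 m = mk↔ₛ′ (λ _ → zero) (λ _ → ⊥ , ∣⊥∣≡0 m)
  (λ { zero → refl }) (λ { (p , eq) → SubsetOfSize-≡ (sym (∣p∣≡0⇒p≡⊥ eq)) })

SubsetOfSize[0,1+r]↔Fin0 : ∀ r → SubsetOfSize 0 (suc r) ↔ Fin 0
SubsetOfSize[0,1+r]↔Fin0 r = mk↔ₛ′ (λ { ([] , ()) }) (λ ()) (λ ()) (λ { ([] , ()) })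

SubsetOfSize-suc↔⊎ : ∀ m r →
  SubsetOfSize (suc m) (suc r) ↔ (SubsetOfSize m r ⊎ SubsetOfSize m (suc r))
SubsetOfSize-suc↔⊎ m r = mk↔ₛ′ split merge split∘merge merge∘split
  where
  split : SubsetOfSize (suc m) (suc r) → SubsetOfSize m r ⊎ SubsetOfSize m (suc r)
  split (inside  ∷ p , eq) = inj₁ (p , suc-injective eq)
  split (outside ∷ p , eq) = inj₂ (p , eq)

  merge : SubsetOfSize m r ⊎ SubsetOfSize m (suc r) → SubsetOfSize (suc m) (suc r)
  merge (inj₁ (p , eq)) = inside  ∷ p , cong suc eq
  merge (inj₂ (p , eq)) = outside ∷ p , eq

  split∘merge : ∀ x → split (merge x) ≡ x
  split∘merge (inj₁ _) = cong inj₁ (SubsetOfSize-≡ refl)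
  split∘merge (inj₂ _) = refl

  merge∘split : ∀ x → merge (split x) ≡ x
  merge∘split (inside  ∷ _ , _) = SubsetOfSize-≡ refl
  merge∘split (outside ∷ _ , _) = refl

SubsetOfSize↔Fin[mCr] : ∀ m r → SubsetOfSize m r ↔ Fin (m C r)
SubsetOfSize↔Fin[mCr] m       zero    = SubsetOfSize[m,0]↔Fin1 m
SubsetOfSize↔Fin[mCr] zero    (suc r) = SubsetOfSize[0,1+r]↔Fin0 r
SubsetOfSize↔Fin[mCr] (suc m) (suc r) =
  subst (λ k → SubsetOfSize (suc m) (suc r) ↔ Fin k) (nCk+nC[k+1]≡[n+1]C[k+1] m r)
    (↔-trans (SubsetOfSize-suc↔⊎ m r)
      (↔-trans (SubsetOfSize↔Fin[mCr] m r ⊎-cong SubsetOfSize↔Fin[mCr] m (suc r))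
        (↔-sym +↔⊎)))

_Enumerates_ : ∀ {k m} → (Fin k → Fin m) → Subset m → Set
_Enumerates_ {m = m} g p = ∀ (x : Fin m) → x ∈ p ⇔ (∃[ i ] g i ≡ x)

enumerate : ∀ {m} (p : Subset m) → Fin ∣ p ∣ → Fin m
enumerate (inside  ∷ p) zero    = zero
enumerate (inside  ∷ p) (suc i) = suc (enumerate p i)
enumerate (outside ∷ p) i       = suc (enumerate p i)

enumerate-injective : ∀ {m} (p : Subset m) → Injective _≡_ _≡_ (enumerate p)
enumerate-injective (inside  ∷ p) {zero}  {zero}  _  = refl
enumerate-injective (inside  ∷ p) {suc i} {suc j} eq =
  cong suc (enumerate-injective p (Fin.suc-injective eq))
enumerate-injective (outside ∷ p)                 eq = enumerate-injective p (Fin.suc-injective eq)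

enumerate-∈ : ∀ {m} (p : Subset m) i → enumerate p i ∈ p
enumerate-∈ (inside  ∷ p) zero    = here
enumerate-∈ (inside  ∷ p) (suc i) = there (enumerate-∈ p i)
enumerate-∈ (outside ∷ p) i       = there (enumerate-∈ p i)

∈⇒enumerated : ∀ {m} (p : Subset m) {x} → x ∈ p → ∃[ i ] enumerate p i ≡ x
∈⇒enumerated (inside  ∷ p) here          = zero , refl
∈⇒enumerated (inside  ∷ p) (there x∈p) with ∈⇒enumerated p x∈p
... | i , refl = suc i , refl
∈⇒enumerated (outside ∷ p) (there x∈p) with ∈⇒enumerated p x∈p
... | i , refl = i , refl

enumerate-enumerates : ∀ {m} (p : Subset m) → enumerate p Enumerates p
enumerate-enumerates p x = mk⇔ (∈⇒enumerated p) λ { (i , refl) → enumerate-∈ p i }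

enumerates-≤ : ∀ {a b m} {g : Fin a → Fin m} {h : Fin b → Fin m} {p : Subset m} →
  Injective _≡_ _≡_ g → g Enumerates p → h Enumerates p → a ≤ b
enumerates-≤ {g = g} {h} g-injective g-enum h-enum = injective⇒≤ preimage-injective
  where
  preimage : ∀ i → ∃[ j ] h j ≡ g i
  preimage i = Equivalence.to (h-enum (g i)) (Equivalence.from (g-enum (g i)) (i , refl))

  preimage-injective : Injective _≡_ _≡_ (proj₁ ∘ preimage)
  preimage-injective {i} {i′} eq =
    g-injective (trans (sym (proj₂ (preimage i))) (trans (cong h eq) (proj₂ (preimage i′))))

enumerates⇒∣p∣≡k : ∀ {k m} {g : Fin k → Fin m} {p : Subset m} →
  Injective _≡_ _≡_ g → g Enumerates p → ∣ p ∣ ≡ k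
enumerates⇒∣p∣≡k {p = p} g-injective g-enum = ≤-antisym
  (enumerates-≤ (enumerate-injective p) (enumerate-enumerates p) g-enum)
  (enumerates-≤ g-injective g-enum (enumerate-enumerates p))

SameEdge-sym : ∀ {n} {x y : Fin n × Fin n} → SameEdge x y → SameEdge y x
SameEdge-sym (inj₁ (refl , refl)) = inj₁ (refl , refl)
SameEdge-sym (inj₂ (refl , refl)) = inj₂ (refl , refl)

SameEdge-trans : ∀ {n} {x y z : Fin n × Fin n} → SameEdge x y → SameEdge y z → SameEdge x z
SameEdge-trans (inj₁ (refl , refl)) yz                   = yz
SameEdge-trans (inj₂ (refl , refl)) (inj₁ (refl , refl)) = inj₂ (refl , refl)
SameEdge-trans (inj₂ (refl , refl)) (inj₂ (refl , refl)) = inj₁ (refl , refl)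

SameEdge-sharedEnd : ∀ {n} {c u v : Fin n} → SameEdge (c , u) (c , v) → u ≡ v ⊎ c ≡ v
SameEdge-sharedEnd (inj₁ (_ , u≡v)) = inj₁ u≡v
SameEdge-sharedEnd (inj₂ (c≡v , _)) = inj₂ c≡v

IsCopyK[1,r]⇒∣S∣≡r : ∀ {n m r} (G : Graph n m) {S : Subset m} → IsCopyK 1 r G S → ∣ S ∣ ≡ r
IsCopyK[1,r]⇒∣S∣≡r {m = m} {r} G {S} (f , f-injective , adj , S-edges) =
  enumerates⇒∣p∣≡k spoke-injective spoke-enumerates
  where
  spoke : Fin r → Fin m
  spoke j = proj₁ (adj 0F j)

  spoke-edge : ∀ j → SameEdge (edge G (spoke j)) (f (inj₁ 0F) , f (inj₂ j))
  spoke-edge j = proj₂ (adj 0F j)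

  spoke-injective : Injective _≡_ _≡_ spoke
  spoke-injective {i} {j} eq with SameEdge-sharedEnd
    (SameEdge-trans (SameEdge-sym (spoke-edge i)) (subst (λ e → SameEdge (edge G e) _) (sym eq) (spoke-edge j)))
  ... | inj₁ leaves≡ = inj₂-injective (f-injective _ _ leaves≡)
  ... | inj₂ centre≡leaf with f-injective _ _ centre≡leaf
  ...   | ()

  spoke-enumerates : spoke Enumerates S
  spoke-enumerates e = mk⇔
    (λ e∈S → case Equivalence.to (S-edges e) e∈S of λ where
       (0F , j , e~j) → j , distinct G _ _ (SameEdge-trans (spoke-edge j) (SameEdge-sym e~j)))
    λ { (j , refl) → Equivalence.from (S-edges (spoke j)) (0F , j , spoke-edge j) }

atMostCopies-K[1,r] : ∀ {n m} r (G : Graph n m) → AtMostCopies 1 r G (m C r)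
atMostCopies-K[1,r] {m = m} r G k L L-injective L-copies = injective⇒≤ index-injective
  where
  index : Fin k → Fin (m C r)
  index i = Inverse.to (SubsetOfSize↔Fin[mCr] m r) (L i , IsCopyK[1,r]⇒∣S∣≡r G (L-copies i))

  index-injective : Injective _≡_ _≡_ index
  index-injective eq =
    L-injective _ _ (cong proj₁ (Injection.injective (↔⇒↣ (SubsetOfSize↔Fin[mCr] m r)) eq))

star : ∀ m → Graph (suc m) m
star m = record
  { edge     = λ e → zero , suc e
  ; loopless = λ _ ()
  ; distinct = λ { _ _ (inj₁ (_ , eq)) → Fin.suc-injective eq }
  }

star-Adj⇒centre : ∀ {m} {u v : Fin (suc m)} → Adj (star m) u v → u ≡ zero ⊎ v ≡ zero
star-Adj⇒centre (_ , inj₁ (centre≡u , _)) = inj₁ (sym centre≡u)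
star-Adj⇒centre (_ , inj₂ (centre≡v , _)) = inj₂ (sym centre≡v)

star-KFree : ∀ {m s t} → 2 ≤ s → 2 ≤ t → KFree s t (star m)
star-KFree (s≤s (s≤s _)) (s≤s (s≤s _)) (f , f-injective , adj) =
  disjointEdges (star-Adj⇒centre (adj 0F 0F)) (star-Adj⇒centre (adj 1F 1F))
  where
  twoCentres : ∀ {x y} → x ≢ y → f x ≡ zero → f y ≡ zero → Empty.⊥
  twoCentres x≢y fx fy = x≢y (f-injective _ _ (trans fx (sym fy)))

  disjointEdges : f (inj₁ 0F) ≡ zero ⊎ f (inj₂ 0F) ≡ zero →
                  f (inj₁ 1F) ≡ zero ⊎ f (inj₂ 1F) ≡ zero → Empty.⊥
  disjointEdges (inj₁ a₀) (inj₁ a₁) = twoCentres (λ ()) a₀ a₁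
  disjointEdges (inj₁ a₀) (inj₂ b₁) = twoCentres (λ ()) a₀ b₁
  disjointEdges (inj₂ b₀) (inj₁ a₁) = twoCentres (λ ()) b₀ a₁
  disjointEdges (inj₂ b₀) (inj₂ b₁) = twoCentres (λ ()) b₀ b₁

star-copy : ∀ {m r} {S : Subset m} → ∣ S ∣ ≡ r → IsCopyK 1 r (star m) S
star-copy {m} {S = S} refl = f , f-injective , (λ _ j → enumerate S j , inj₁ (refl , refl)) , S-edges
  where
  f : KV 1 ∣ S ∣ → Fin (suc m)
  f (inj₁ _) = zero
  f (inj₂ j) = suc (enumerate S j)

  f-injective : InjectiveMap f
  f-injective (inj₁ 0F) (inj₁ 0F) _  = refl
  f-injective (inj₂ i)  (inj₂ j)  eq = cong inj₂ (enumerate-injective S (Fin.suc-injective eq))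

  S-edges : ∀ e → e ∈ S ⇔ (∃[ i ] ∃[ j ] SameEdge (zero , suc e) (f (inj₁ i) , f (inj₂ j)))
  S-edges e = mk⇔
    (λ e∈S → case ∈⇒enumerated S e∈S of λ where
       (j , refl) → 0F , j , inj₁ (refl , refl))
    λ { (_ , j , inj₁ (_ , eq)) → subst (_∈ S) (sym (Fin.suc-injective eq)) (enumerate-∈ S j) }

atLeastCopies-star : ∀ m r → AtLeastCopies 1 r (star m) (m C r)
atLeastCopies-star m r = proj₁ ∘ choose , choose-injective , star-copy ∘ proj₂ ∘ choose
  where
  choose : Fin (m C r) → SubsetOfSize m r
  choose = Inverse.from (SubsetOfSize↔Fin[mCr] m r)

  choose-injective : ∀ i j → proj₁ (choose i) ≡ proj₁ (choose j) → i ≡ j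
  choose-injective i j eq =
    Injection.injective (↔⇒↣ (↔-sym (SubsetOfSize↔Fin[mCr] m r))) (SubsetOfSize-≡ eq)

proposition5p2 : ∀ (r s t : ℕ) → 1 ≤ r → 2 ≤ s → s ≤ t →
                   ∀ (m : ℕ) → MexK m 1 r s t (m C r)
proposition5p2 r s t _ 2≤s s≤t m =
  (suc m , star m , star-KFree 2≤s (≤-trans 2≤s s≤t) , atLeastCopies-star m r) ,
  λ n G _ → atMostCopies-K[1,r] r G
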